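{- For a Latin square $L$ of order $n$, $\mathrm{mcs}(L)=3n-1-\mathrm{scc}(L)$.
   Context: A Latin square $L$ of order $n$ is identified with its set of entries $(r,c,s)$ (symbol $s$ in row $r$, column $c$). A line of $L$ is the set of entries in a fixed row, a fixed column, or with a fixed symbol. A cover-sequence for $L$ is a sequence $(e_1,\dots,e_d)$ of entries of $L$ such that (1) every row, column and symbol of $L$ is represented in $\{e_1,\dots,e_d\}$, and (2) for each $i$, $e_i$ contains a row, a column, or a symbol not represented in $\{e_1,\dots,e_{i-1}\}$; $\mathrm{mcs}(L)$ is the maximum length of a cover-sequence. A subsquare of $L$ is a subset of the entries of $L$ that is itself a Latin square (on its own set of rows, columns and symbols); a subsquare intersects a line $\ell$ if it contains an entry of $\ell$. A chain of $L$ is a sequence of subsquares $\emptyset=S_0\subseteq S_1\subseteq\cdots\subseteq S_\alpha=L$ where $S_1$ consists of a single entry. The chain is connected if for each $i$ with $1\le i\le\alpha$ there is a line $\ell$ intersecting $S_i$ but not $S_{i-1}$ such that $S_i$ is the smallest subsquare of $L$ that intersects $\ell$ and contains all entries of $S_{i-1}$. The length of the chain is $\alpha$, and $\mathrm{scc}(L)$ is the minimum length of a connected chain of $L$. -}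

module Defs where

open import Data.Nat using (ℕ; zero; suc; _+_; _*_; _≤_)
open import Data.Fin using (Fin; toℕ)
open import Data.Product using (Σ; ∃; _×_; _,_; proj₁; proj₂)
open import Data.Sum using (_⊎_)
open import Data.List using (List; length; take; lookup)
open import Data.List.Relation.Unary.Any using (Any)
open import Relation.Binary.PropositionalEquality using (_≡_)
open import Relation.Nullary using (¬_)
open import Function.Definitions using (Injective)
open import Level using () renaming (suc to lsuc; zero to lzero)

-- A Latin square of order n: an n×n array over symbols Fin n in which
-- each symbol occurs at most (hence exactly) once in every row and column.
record LatinSquare (n : ℕ) : Set where
  field
    L       : Fin n → Fin n → Fin n
    row-inj : ∀ r → Injective _≡_ _≡_ (L r)
    col-inj : ∀ c → Injective _≡_ _≡_ (λ r → L r c)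

module _ {n : ℕ} (LS : LatinSquare n) where
  open LatinSquare LS

  Cell : Set
  Cell = Fin n × Fin n

  rowOf : Cell → Fin n
  rowOf = proj₁

  colOf : Cell → Fin n
  colOf = proj₂

  symOf : Cell → Fin n
  symOf e = L (proj₁ e) (proj₂ e)

  Covers : List Cell → Set
  Covers es = (∀ r → Any (λ e → rowOf e ≡ r) es)
            × (∀ c → Any (λ e → colOf e ≡ c) es)
            × (∀ s → Any (λ e → symOf e ≡ s) es)

  HasNew : List Cell → Cell → Set
  HasNew pre e = (¬ Any (λ e' → rowOf e' ≡ rowOf e) pre)
               ⊎ (¬ Any (λ e' → colOf e' ≡ colOf e) pre)
               ⊎ (¬ Any (λ e' → symOf e' ≡ symOf e) pre)

  IsCoverSeq : List Cell → Set
  IsCoverSeq es = Covers es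
                × (∀ (i : Fin (length es)) → HasNew (take (toℕ i) es) (lookup es i))

  IsMCS : ℕ → Set
  IsMCS m = (Σ (List Cell) λ es → IsCoverSeq es × length es ≡ m)
          × (∀ es → IsCoverSeq es → length es ≤ m)

  Entries : Set₁
  Entries = Cell → Set

  _⊆_ : Entries → Entries → Set
  S ⊆ T = ∀ e → S e → T e

  data Line : Set where
    row col sym : Fin n → Line

  OnLine : Line → Cell → Set
  OnLine (row r) e = rowOf e ≡ r
  OnLine (col c) e = colOf e ≡ c
  OnLine (sym s) e = symOf e ≡ s

  Intersects : Entries → Line → Set
  Intersects S ℓ = ∃ λ e → S e × OnLine ℓ e

  RowOfS : Entries → Fin n → Set
  RowOfS S r = ∃ λ c → S (r , c)

  ColOfS : Entries → Fin n → Set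
  ColOfS S c = ∃ λ r → S (r , c)

  SymOfS : Entries → Fin n → Set
  SymOfS S s = ∃ λ e → S e × symOf e ≡ s

  -- S is itself a Latin square on its own rows R, columns C, symbols Σ:
  -- every cell of R × C is filled (by an entry of S), and every symbol of Σ
  -- occurs in every row of R and every column of C (at most once is
  -- inherited from L).
  IsSubsquare : Entries → Set
  IsSubsquare S =
      (∀ r c → RowOfS S r → ColOfS S c → S (r , c))
    × (∀ r s → RowOfS S r → SymOfS S s → ∃ λ c → S (r , c) × symOf (r , c) ≡ s)
    × (∀ c s → ColOfS S c → SymOfS S s → ∃ λ r → S (r , c) × symOf (r , c) ≡ s)

  -- A chain of length α: subsquares S 0 ⊆ S 1 ⊆ … ⊆ S α (values of S
  -- beyond α are irrelevant) with S 0 = ∅, S 1 a single entry, S α = L.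
  IsChain : ℕ → (ℕ → Entries) → Set
  IsChain α S =
      (1 ≤ α)
    × (∀ i → i ≤ α → IsSubsquare (S i))
    × (∀ i → suc i ≤ α → S i ⊆ S (suc i))
    × (∀ e → ¬ S 0 e)
    × (∃ λ e → S 1 e × (∀ e' → S 1 e' → e' ≡ e))
    × (∀ e → S α e)

  IsSmallest : Entries → Line → Entries → Set₁
  IsSmallest S ℓ S' =
      IsSubsquare S' × Intersects S' ℓ × S ⊆ S'
    × (∀ (T : Entries) → IsSubsquare T → Intersects T ℓ → S ⊆ T → S' ⊆ T)

  IsConnected : ℕ → (ℕ → Entries) → Set₁
  IsConnected α S =
    ∀ i → suc i ≤ α →
      Σ Line λ ℓ → Intersects (S (suc i)) ℓ × ¬ Intersects (S i) ℓ
                 × (1 ≤ i → IsSmallest (S i) ℓ (S (suc i)))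

  IsSCC : ℕ → Set₁
  IsSCC k = (Σ (ℕ → Entries) λ S → IsChain k S × IsConnected k S)
          × (∀ α (S : ℕ → Entries) → IsChain α S → IsConnected α S → k ≤ α)

module Submission where

-- Each entry of a cover-sequence covers between one and three new lines out of the 3n, and a
-- subsquare is a set of entries whose lines are closed under "two lines of an entry give the
-- third".  An entry covering k new lines can be absorbed into a connected chain by at most k - 1
-- steps (adjoin the missing row and/or column and close), so a cover-sequence of length d gives
-- a connected chain of length α with α + d + 1 ≤ 3n.  Conversely each step of a connected chain
-- is realised by one entry on the new line covering at most two new lines (it can be chosen in
-- the row or column of the initial entry, which lies in every member) followed by entries
-- completing the closure, each covering exactly one new line, so a chain of length α gives a
-- cover-sequence of length d with 3n ≤ α + d + 1.

open import Data.Empty using (⊥; ⊥-elim)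
open import Data.Fin.Base using (Fin; zero; suc; toℕ; punchOut)
open import Data.Fin.Properties using (any?; all?; _≟_; punchOut-injective; injective⇒≤)
open import Data.Fin.Subset using (Subset; ⁅_⁆; _∪_; ∣_∣; _∈_; _∉_; inside; outside)
import Data.Fin.Subset as Subset
open import Data.Fin.Subset.Properties
  using (_∈?_; x∈⁅x⁆; x∈⁅y⁆⇒x≡y; x∈p∪q⁻; p⊆p∪q; q⊆p∪q; ⊆-antisym; ∪-identityʳ; ∉⊥; ∣⊥∣≡0; ∣⊤∣≡n; ∣p∣≤n;
         p⊆q⇒∣p∣≤∣q∣)
open import Data.List.Base using (List; []; _∷_; _++_; length; take; lookup; foldl)
open import Data.List.Properties using (foldl-++; length-++)
open import Data.List.Relation.Unary.Any as Any using (Any; here; there)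
open import Data.Nat.Base using (ℕ; zero; suc; _+_; _*_; _≤_; _<_; z≤n; s≤s)
open import Data.Nat.Properties
  using (_≤?_; ≤-refl; ≤-reflexive; ≤-trans; ≤-antisym; <-irrefl; <-≤-trans; ≤-pred; ≤∧≢⇒<; ≤⇒≯; ≮⇒≥;
         n≤0⇒n≡0; n≤1+n; m≤n+m; m<m+n; suc-injective; +-comm; +-assoc; +-suc; +-identityʳ;
         +-mono-≤; +-monoˡ-≤; +-monoʳ-≤; +-cancelʳ-≤; module ≤-Reasoning)
open import Data.Nat.Tactic.RingSolver using (solve-∀)
open import Data.Product using (Σ; ∃; ∃₂; _×_; _,_; proj₁; proj₂)
open import Data.Sum using (_⊎_; inj₁; inj₂; [_,_])
import Data.Sum as Sum
open import Data.Unit using (⊤; tt)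
open import Data.Vec.Base using (_∷_) renaming (here to hereᵥ; there to thereᵥ)
open import Function.Base using (id; _∘_)
open import Function.Definitions using (Injective)
open import Relation.Nullary using (Dec; yes; no; ¬_; ¬?)
open import Relation.Nullary.Decidable as Dec using (_×-dec_; _⊎-dec_; toSum)
open import Relation.Binary.PropositionalEquality as ≡ using (_≡_; refl; cong; cong₂; subst; subst₂)

open import Defs

all-or-any : ∀ {m} {P Q : Fin m → Set} → (∀ i → P i ⊎ Q i) → (∀ i → P i) ⊎ ∃ Q
all-or-any {zero} _ = inj₁ λ ()
all-or-any {suc m} dec with dec zero | all-or-any (dec ∘ suc)
... | inj₂ q | _ = inj₂ (zero , q)
... | inj₁ _ | inj₂ (i , q) = inj₂ (suc i , q)
... | inj₁ p | inj₁ ps = inj₁ λ { zero → p ; (suc i) → ps i }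

implies-or-refuted : ∀ {A B C : Set} → Dec A → Dec B → Dec C → (A → B → C) ⊎ (A × B × ¬ C)
implies-or-refuted (yes a) (yes b) (no ¬c) = inj₂ (a , b , ¬c)
implies-or-refuted _ _ (yes c) = inj₁ λ _ _ → c
implies-or-refuted (no ¬a) _ _ = inj₁ λ a → ⊥-elim (¬a a)
implies-or-refuted _ (no ¬b) _ = inj₁ λ _ b → ⊥-elim (¬b b)

greatest : ∀ {P : ℕ → Set} → (∀ d → Dec (P d)) → ∀ {B d₀} →
           (∀ d → P d → d ≤ B) → P d₀ → ∃ λ m → P m × (∀ d → P d → d ≤ m)
greatest {P} P? {B} {d₀} bounded p₀ = search B bounded
  where
  search : ∀ k → (∀ d → P d → d ≤ k) → ∃ λ m → P m × (∀ d → P d → d ≤ m)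
  search k below with P? k
  ... | yes pk = k , pk , below
  search zero below | no ¬p0 = ⊥-elim (¬p0 (subst P (n≤0⇒n≡0 (below d₀ p₀)) p₀))
  search (suc k) below | no ¬pk =
    search k λ d pd → ≤-pred (≤∧≢⇒< (below d pd) λ { refl → ¬pk pd })

∃-list? : ∀ {A : Set} → (∀ {P : A → Set} → (∀ x → Dec (P x)) → Dec (∃ P)) →
          ∀ {Q : List A → Set} → (∀ xs → Dec (Q xs)) → ∀ d → Dec (∃ λ xs → Q xs × length xs ≡ d)
∃-list? any?ᴬ Q? zero with Q? []
... | yes q = yes ([] , q , refl)
... | no ¬q = no λ { ([] , q , _) → ¬q q }
∃-list? any?ᴬ {Q} Q? (suc d) with any?ᴬ (λ x → ∃-list? any?ᴬ {Q ∘ (x ∷_)} (Q? ∘ (x ∷_)) d)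
... | yes (x , xs , q , len) = yes (x ∷ xs , q , cong suc len)
... | no ¬w = no λ { (x ∷ xs , q , len) → ¬w (x , xs , q , suc-injective len) }

injective⇒surjective : ∀ {m} (f : Fin m → Fin m) → Injective _≡_ _≡_ f → ∀ y → ∃ λ x → f x ≡ y
injective⇒surjective {suc m} f f-inj y with any? (λ x → f x ≟ y)
... | yes hit = hit
... | no miss = ⊥-elim (<-irrefl refl (injective⇒≤ avoid-inj))
  where
  y≢f : ∀ x → y ≡.≢ f x
  y≢f x y≡fx = miss (x , ≡.sym y≡fx)
  avoid-inj : Injective _≡_ _≡_ (λ x → punchOut (y≢f x))
  avoid-inj {x₁} {x₂} eq = f-inj (punchOut-injective (y≢f x₁) (y≢f x₂) eq)

n+n+n≡3*n : ∀ n → n + n + n ≡ 3 * n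
n+n+n≡3*n = solve-∀

missing : ∀ {n} → Fin n → Subset n → ℕ
missing x p with x ∈? p
... | yes _ = 0
... | no _ = 1

∣p∪⁅x⁆∣≡1+∣p∣ : ∀ {n} {x : Fin n} (p : Subset n) → x ∉ p → ∣ p ∪ ⁅ x ⁆ ∣ ≡ suc ∣ p ∣
∣p∪⁅x⁆∣≡1+∣p∣ {x = zero} (outside ∷ p) _ = cong (suc ∘ ∣_∣) (∪-identityʳ p)
∣p∪⁅x⁆∣≡1+∣p∣ {x = zero} (inside ∷ p) x∉ = ⊥-elim (x∉ hereᵥ)
∣p∪⁅x⁆∣≡1+∣p∣ {x = suc x} (outside ∷ p) x∉ = ∣p∪⁅x⁆∣≡1+∣p∣ p (x∉ ∘ thereᵥ)
∣p∪⁅x⁆∣≡1+∣p∣ {x = suc x} (inside ∷ p) x∉ = cong suc (∣p∪⁅x⁆∣≡1+∣p∣ p (x∉ ∘ thereᵥ))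

∈⇒p∪⁅x⁆≡p : ∀ {n} {x : Fin n} (p : Subset n) → x ∈ p → p ∪ ⁅ x ⁆ ≡ p
∈⇒p∪⁅x⁆≡p {x = x} p x∈ = ⊆-antisym (λ y∈ → [ id , back ] (x∈p∪q⁻ p _ y∈)) (p⊆p∪q _)
  where
  back : ∀ {y} → y ∈ ⁅ x ⁆ → y ∈ p
  back y∈⁅x⁆ = subst (_∈ p) (≡.sym (x∈⁅y⁆⇒x≡y x y∈⁅x⁆)) x∈

∣p∪⁅x⁆∣≡∣p∣+missing : ∀ {n} (x : Fin n) (p : Subset n) → ∣ p ∪ ⁅ x ⁆ ∣ ≡ ∣ p ∣ + missing x p
∣p∪⁅x⁆∣≡∣p∣+missing x p with x ∈? p
... | yes x∈ = ≡.trans (cong ∣_∣ (∈⇒p∪⁅x⁆≡p p x∈)) (≡.sym (+-identityʳ _))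
... | no x∉ = ≡.trans (∣p∪⁅x⁆∣≡1+∣p∣ p x∉) (+-comm 1 _)

missing-∈ : ∀ {n} {x : Fin n} {p} → x ∈ p → missing x p ≡ 0
missing-∈ {x = x} {p} x∈ with x ∈? p
... | yes _ = refl
... | no x∉ = ⊥-elim (x∉ x∈)

missing-∉ : ∀ {n} {x : Fin n} {p} → x ∉ p → missing x p ≡ 1
missing-∉ {x = x} {p} x∉ with x ∈? p
... | yes x∈ = ⊥-elim (x∉ x∈)
... | no _ = refl

1≤missing : ∀ {n} {x : Fin n} {p} → x ∉ p → 1 ≤ missing x p
1≤missing x∉ = ≤-reflexive (≡.sym (missing-∉ x∉))

missing≤0 : ∀ {n} {x : Fin n} {p} → x ∈ p → missing x p ≤ 0
missing≤0 x∈ = ≤-reflexive (missing-∈ x∈)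

missing≤1 : ∀ {n} (x : Fin n) p → missing x p ≤ 1
missing≤1 x p with x ∈? p
... | yes _ = z≤n
... | no _ = s≤s z≤n

module _ {n : ℕ} (LS : LatinSquare n) where
  open LatinSquare LS

  -- The rows, columns and symbols of L are its lines; a set of lines is kept as three subsets of
  -- Fin n so that membership is decidable and the set can be counted.
  record LineSet : Set where
    constructor ⟨_,_,_⟩
    field
      rows cols syms : Subset n
  open LineSet

  infix 4 _∈ₗ_ _∉ₗ_ _⊑_
  infixl 6 _⊕_

  _∈ₗ_ : Line LS → LineSet → Set
  row r ∈ₗ I = r ∈ rows I
  col c ∈ₗ I = c ∈ cols I
  sym s ∈ₗ I = s ∈ syms I

  _∉ₗ_ : Line LS → LineSet → Set
  ℓ ∉ₗ I = ¬ ℓ ∈ₗ I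

  _∈ₗ?_ : ∀ ℓ I → Dec (ℓ ∈ₗ I)
  row r ∈ₗ? I = r ∈? rows I
  col c ∈ₗ? I = c ∈? cols I
  sym s ∈ₗ? I = s ∈? syms I

  ⟦_⟧ : LineSet → Line LS → Set
  ⟦ I ⟧ ℓ = ℓ ∈ₗ I

  _⊑_ : (Line LS → Set) → (Line LS → Set) → Set
  P ⊑ Q = ∀ ℓ → P ℓ → Q ℓ

  through : Cell LS → Line LS → Set
  through e ℓ = OnLine LS ℓ e

  through-⊑ : ∀ {P r c} → P (row r) → P (col c) → P (sym (L r c)) → through (r , c) ⊑ P
  through-⊑ r∈ _ _ (row _) refl = r∈
  through-⊑ _ c∈ _ (col _) refl = c∈
  through-⊑ _ _ s∈ (sym _) refl = s∈

  ∅ : LineSet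
  ∅ = ⟨ Subset.⊥ , Subset.⊥ , Subset.⊥ ⟩

  ∉∅ : ∀ ℓ → ℓ ∉ₗ ∅
  ∉∅ (row _) = ∉⊥
  ∉∅ (col _) = ∉⊥
  ∉∅ (sym _) = ∉⊥

  _⊕_ : LineSet → Cell LS → LineSet
  I ⊕ (r , c) = ⟨ rows I ∪ ⁅ r ⁆ , cols I ∪ ⁅ c ⁆ , syms I ∪ ⁅ L r c ⁆ ⟩

  ∈-⊕⁺ˡ : ∀ {I} e → ⟦ I ⟧ ⊑ ⟦ I ⊕ e ⟧
  ∈-⊕⁺ˡ _ (row _) = p⊆p∪q _
  ∈-⊕⁺ˡ _ (col _) = p⊆p∪q _
  ∈-⊕⁺ˡ _ (sym _) = p⊆p∪q _

  ∈-⊕⁺ʳ : ∀ {I} e → through e ⊑ ⟦ I ⊕ e ⟧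
  ∈-⊕⁺ʳ {I} (r , c) = through-⊑ (q⊆p∪q (rows I) _ (x∈⁅x⁆ r)) (q⊆p∪q (cols I) _ (x∈⁅x⁆ c))
                                 (q⊆p∪q (syms I) _ (x∈⁅x⁆ (L r c)))

  ∈-⊕⁻ : ∀ I e ℓ → ℓ ∈ₗ I ⊕ e → ℓ ∈ₗ I ⊎ through e ℓ
  ∈-⊕⁻ I (r , c) (row x) x∈ = Sum.map₂ (≡.sym ∘ x∈⁅y⁆⇒x≡y r) (x∈p∪q⁻ (rows I) _ x∈)
  ∈-⊕⁻ I (r , c) (col x) x∈ = Sum.map₂ (≡.sym ∘ x∈⁅y⁆⇒x≡y c) (x∈p∪q⁻ (cols I) _ x∈)
  ∈-⊕⁻ I (r , c) (sym x) x∈ = Sum.map₂ (≡.sym ∘ x∈⁅y⁆⇒x≡y (L r c)) (x∈p∪q⁻ (syms I) _ x∈)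

  ⊕-⊑ : ∀ {I P} e → ⟦ I ⟧ ⊑ P → through e ⊑ P → ⟦ I ⊕ e ⟧ ⊑ P
  ⊕-⊑ {I} e I⊑P e⊑P ℓ = [ I⊑P ℓ , e⊑P ℓ ] ∘ ∈-⊕⁻ I e ℓ

  ∅⊕-⊑ : ∀ e → ⟦ ∅ ⊕ e ⟧ ⊑ through e
  ∅⊕-⊑ e ℓ = [ ⊥-elim ∘ ∉∅ ℓ , id ] ∘ ∈-⊕⁻ ∅ e ℓ

  ∈-foldl⁺ˡ : ∀ {I} es → ⟦ I ⟧ ⊑ ⟦ foldl _⊕_ I es ⟧
  ∈-foldl⁺ˡ [] ℓ = id
  ∈-foldl⁺ˡ (e ∷ es) ℓ = ∈-foldl⁺ˡ es ℓ ∘ ∈-⊕⁺ˡ e ℓ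

  ∈-foldl⁺ʳ : ∀ {I} es ℓ → Any (OnLine LS ℓ) es → ℓ ∈ₗ foldl _⊕_ I es
  ∈-foldl⁺ʳ (e ∷ es) ℓ (here on) = ∈-foldl⁺ˡ es ℓ (∈-⊕⁺ʳ e ℓ on)
  ∈-foldl⁺ʳ (e ∷ es) ℓ (there on) = ∈-foldl⁺ʳ es ℓ on

  ∈-foldl⁻ : ∀ I es ℓ → ℓ ∈ₗ foldl _⊕_ I es → ℓ ∈ₗ I ⊎ Any (OnLine LS ℓ) es
  ∈-foldl⁻ I [] ℓ = inj₁
  ∈-foldl⁻ I (e ∷ es) ℓ ℓ∈ with ∈-foldl⁻ (I ⊕ e) es ℓ ℓ∈
  ... | inj₂ on = inj₂ (there on)
  ... | inj₁ ℓ∈I⊕e = Sum.map₂ here (∈-⊕⁻ I e ℓ ℓ∈I⊕e)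

  covered : List (Cell LS) → LineSet
  covered = foldl _⊕_ ∅

  ∈-covered⁺ : ∀ es ℓ → Any (OnLine LS ℓ) es → ℓ ∈ₗ covered es
  ∈-covered⁺ = ∈-foldl⁺ʳ

  ∈-covered⁻ : ∀ es ℓ → ℓ ∈ₗ covered es → Any (OnLine LS ℓ) es
  ∈-covered⁻ es ℓ = [ ⊥-elim ∘ ∉∅ ℓ , id ] ∘ ∈-foldl⁻ ∅ es ℓ

  Full : LineSet → Set
  Full I = ∀ ℓ → ℓ ∈ₗ I

  size : LineSet → ℕ
  size I = ∣ rows I ∣ + ∣ cols I ∣ + ∣ syms I ∣

  size≤3n : ∀ I → size I ≤ 3 * n
  size≤3n I = ≤-trans (+-mono-≤ (+-mono-≤ (∣p∣≤n (rows I)) (∣p∣≤n (cols I))) (∣p∣≤n (syms I)))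
                      (≤-reflexive (n+n+n≡3*n n))

  full⇒3n≤size : ∀ {I} → Full I → 3 * n ≤ size I
  full⇒3n≤size {I} full = ≤-trans (≤-reflexive (≡.sym (n+n+n≡3*n n)))
    (+-mono-≤ (+-mono-≤ (n≤∣p∣ (full ∘ row)) (n≤∣p∣ (full ∘ col))) (n≤∣p∣ (full ∘ sym)))
    where
    n≤∣p∣ : ∀ {p : Subset n} → (∀ x → x ∈ p) → n ≤ ∣ p ∣
    n≤∣p∣ all∈ = ≤-trans (≤-reflexive (≡.sym (∣⊤∣≡n n))) (p⊆q⇒∣p∣≤∣q∣ {p = Subset.⊤} (λ {x} _ → all∈ x))

  gain : LineSet → Cell LS → ℕ
  gain I (r , c) = missing r (rows I) + missing c (cols I) + missing (L r c) (syms I)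

  size-⊕ : ∀ I e → size (I ⊕ e) ≡ size I + gain I e
  size-⊕ I (r , c) = ≡.trans
    (cong₂ _+_ (cong₂ _+_ (∣p∪⁅x⁆∣≡∣p∣+missing r (rows I)) (∣p∪⁅x⁆∣≡∣p∣+missing c (cols I)))
               (∣p∪⁅x⁆∣≡∣p∣+missing (L r c) (syms I)))
    (regroup (∣ rows I ∣) (∣ cols I ∣) (∣ syms I ∣)
             (missing r (rows I)) (missing c (cols I)) (missing (L r c) (syms I)))
    where
    regroup : ∀ a b d x y z → a + x + (b + y) + (d + z) ≡ a + b + d + (x + y + z)
    regroup = solve-∀

  size-∅⊕ : ∀ e → size (∅ ⊕ e) ≡ 3
  size-∅⊕ (r , c) = ≡.trans (size-⊕ ∅ (r , c))
    (cong₂ _+_ (cong₂ _+_ (cong₂ _+_ (∣⊥∣≡0 n) (∣⊥∣≡0 n)) (∣⊥∣≡0 n))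
               (cong₂ _+_ (cong₂ _+_ (missing-∉ {x = r} ∉⊥) (missing-∉ {x = c} ∉⊥))
                          (missing-∉ {x = L r c} ∉⊥)))

  Fresh : LineSet → Cell LS → Set
  Fresh I (r , c) = row r ∉ₗ I ⊎ col c ∉ₗ I ⊎ sym (L r c) ∉ₗ I

  gain-≥ : ∀ I r c {a b d} → a ≤ missing r (rows I) → b ≤ missing c (cols I) →
           d ≤ missing (L r c) (syms I) → a + b + d ≤ gain I (r , c)
  gain-≥ I r c p q s = +-mono-≤ (+-mono-≤ p q) s

  gain-≤ : ∀ I r c {a b d} → missing r (rows I) ≤ a → missing c (cols I) ≤ b →
           missing (L r c) (syms I) ≤ d → gain I (r , c) ≤ a + b + d
  gain-≤ I r c p q s = +-mono-≤ (+-mono-≤ p q) s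

  fresh⇒1≤gain : ∀ I e → Fresh I e → 1 ≤ gain I e
  fresh⇒1≤gain I (r , c) (inj₁ r∉) = gain-≥ I r c (1≤missing r∉) z≤n z≤n
  fresh⇒1≤gain I (r , c) (inj₂ (inj₁ c∉)) = gain-≥ I r c z≤n (1≤missing c∉) z≤n
  fresh⇒1≤gain I (r , c) (inj₂ (inj₂ s∉)) = gain-≥ I r c z≤n z≤n (1≤missing s∉)

  fresh-on : ∀ {I e} ℓ → through e ℓ → ℓ ∉ₗ I → Fresh I e
  fresh-on (row _) refl = inj₁
  fresh-on (col _) refl = inj₂ ∘ inj₁
  fresh-on (sym _) refl = inj₂ ∘ inj₂

  hasNew⇒fresh : ∀ pre e → HasNew LS pre e → Fresh (covered pre) e
  hasNew⇒fresh pre (r , c) = Sum.map (_∘ ∈-covered⁻ pre (row r))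
                               (Sum.map (_∘ ∈-covered⁻ pre (col c)) (_∘ ∈-covered⁻ pre (sym (L r c))))

  fresh⇒hasNew : ∀ pre e → Fresh (covered pre) e → HasNew LS pre e
  fresh⇒hasNew pre (r , c) = Sum.map (_∘ ∈-covered⁺ pre (row r))
                               (Sum.map (_∘ ∈-covered⁺ pre (col c)) (_∘ ∈-covered⁺ pre (sym (L r c))))

  Successively : (LineSet → Cell LS → Set) → LineSet → List (Cell LS) → Set
  Successively P I [] = ⊤
  Successively P I (e ∷ es) = P I e × Successively P (I ⊕ e) es

  Successively-++ : ∀ {P I} xs {ys} → Successively P I xs →
                    Successively P (foldl _⊕_ I xs) ys → Successively P I (xs ++ ys)
  Successively-++ [] _ qs = qs
  Successively-++ (x ∷ xs) (p , ps) qs = p , Successively-++ xs ps qs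

  Successively-map : ∀ {P Q : LineSet → Cell LS → Set} → (∀ {I e} → P I e → Q I e) →
                     ∀ {I} es → Successively P I es → Successively Q I es
  Successively-map f [] _ = tt
  Successively-map f (e ∷ es) (p , ps) = f p , Successively-map f es ps

  Successively⇒lookup : ∀ {P I} es → Successively P I es →
                        ∀ i → P (foldl _⊕_ I (take (toℕ i) es)) (lookup es i)
  Successively⇒lookup (e ∷ es) (p , _) zero = p
  Successively⇒lookup (e ∷ es) (_ , ps) (suc i) = Successively⇒lookup es ps i

  lookup⇒Successively : ∀ {P I} es → (∀ i → P (foldl _⊕_ I (take (toℕ i) es)) (lookup es i)) →
                        Successively P I es
  lookup⇒Successively [] _ = tt
  lookup⇒Successively (e ∷ es) p = p zero , lookup⇒Successively es (p ∘ suc)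

  coverSeq⇒full×fresh : ∀ es → IsCoverSeq LS es → Full (covered es) × Successively Fresh ∅ es
  coverSeq⇒full×fresh es ((rows-covered , cols-covered , syms-covered) , new) =
      (λ { (row r) → ∈-covered⁺ es (row r) (rows-covered r)
         ; (col c) → ∈-covered⁺ es (col c) (cols-covered c)
         ; (sym s) → ∈-covered⁺ es (sym s) (syms-covered s) })
    , lookup⇒Successively es (λ i → hasNew⇒fresh (take (toℕ i) es) (lookup es i) (new i))

  full×fresh⇒coverSeq : ∀ es → Full (covered es) → Successively Fresh ∅ es → IsCoverSeq LS es
  full×fresh⇒coverSeq es full fresh =
      ( (λ r → ∈-covered⁻ es (row r) (full (row r)))
      , (λ c → ∈-covered⁻ es (col c) (full (col c)))
      , (λ s → ∈-covered⁻ es (sym s) (full (sym s))) )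
    , λ i → fresh⇒hasNew (take (toℕ i) es) (lookup es i) (Successively⇒lookup es fresh i)

  -- The sets of lines met by subsquares are the closed ones: two lines through an entry force the third.
  record ClosedAt (P : Line LS → Set) (r c : Fin n) : Set where
    field
      sym∈ : P (row r) → P (col c) → P (sym (L r c))
      col∈ : P (row r) → P (sym (L r c)) → P (col c)
      row∈ : P (col c) → P (sym (L r c)) → P (row r)

  Closed : (Line LS → Set) → Set
  Closed P = ∀ r c → ClosedAt P r c

  through-closed : ∀ e → Closed (through e)
  through-closed (r₀ , c₀) r c = record
    { sym∈ = λ { refl refl → refl }
    ; col∈ = λ { refl s≡ → row-inj r₀ s≡ }
    ; row∈ = λ { refl s≡ → col-inj c₀ s≡ }
    }

  Closed-resp : ∀ {P Q} → P ⊑ Q → Q ⊑ P → Closed P → Closed Q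
  Closed-resp P⊑Q Q⊑P closed r c = record
    { sym∈ = λ r∈ c∈ → P⊑Q _ (sym∈ (Q⊑P _ r∈) (Q⊑P _ c∈))
    ; col∈ = λ r∈ s∈ → P⊑Q _ (col∈ (Q⊑P _ r∈) (Q⊑P _ s∈))
    ; row∈ = λ c∈ s∈ → P⊑Q _ (row∈ (Q⊑P _ c∈) (Q⊑P _ s∈))
    }
    where open ClosedAt (closed r c)

  ∅⊕-closed : ∀ e → Closed ⟦ ∅ ⊕ e ⟧
  ∅⊕-closed e = Closed-resp (∈-⊕⁺ʳ e) (∅⊕-⊑ e) (through-closed e)

  cell-⊑ : ∀ {J r c} → Closed ⟦ J ⟧ → row r ∈ₗ J → col c ∈ₗ J → through (r , c) ⊑ ⟦ J ⟧
  cell-⊑ {r = r} {c} closed r∈ c∈ = through-⊑ r∈ c∈ (ClosedAt.sym∈ (closed r c) r∈ c∈)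

  occurs-in-row : ∀ r s → ∃ λ c → L r c ≡ s
  occurs-in-row r = injective⇒surjective (L r) (row-inj r)

  occurs-in-col : ∀ c s → ∃ λ r → L r c ≡ s
  occurs-in-col c = injective⇒surjective (λ r → L r c) (col-inj c)

  row-of : ∀ {S r} → Intersects LS S (row r) → RowOfS LS S r
  row-of ((_ , c) , e∈ , refl) = c , e∈

  col-of : ∀ {S c} → Intersects LS S (col c) → ColOfS LS S c
  col-of ((r , _) , e∈ , refl) = r , e∈

  Intersects-mono : ∀ {S T} → _⊆_ LS S T → Intersects LS S ⊑ Intersects LS T
  Intersects-mono S⊆T ℓ (e , e∈ , on) = e , S⊆T e e∈ , on

  subsquare⇒closed : ∀ {S} → IsSubsquare LS S → Closed (Intersects LS S)
  subsquare⇒closed (filled , row-syms , col-syms) r c = record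
    { sym∈ = λ r∈ c∈ → (r , c) , filled r c (row-of r∈) (col-of c∈) , refl
    ; col∈ = λ r∈ s∈ → let c′ , e∈ , eq = row-syms r _ (row-of r∈) s∈ in (r , c′) , e∈ , row-inj r eq
    ; row∈ = λ c∈ s∈ → let r′ , e∈ , eq = col-syms c _ (col-of c∈) s∈ in (r′ , c) , e∈ , col-inj c eq
    }

  cells : LineSet → Entries LS
  cells I (r , c) = row r ∈ₗ I × col c ∈ₗ I

  cells-mono : ∀ {I J} → ⟦ I ⟧ ⊑ ⟦ J ⟧ → _⊆_ LS (cells I) (cells J)
  cells-mono I⊑J (r , c) (r∈ , c∈) = I⊑J (row r) r∈ , I⊑J (col c) c∈

  ⊆-cells : ∀ {S I} → Intersects LS S ⊑ ⟦ I ⟧ → _⊆_ LS S (cells I)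
  ⊆-cells S⊑I (r , c) e∈ = S⊑I (row r) ((r , c) , e∈ , refl) , S⊑I (col c) ((r , c) , e∈ , refl)

  cells-⊆ : ∀ {T I} → IsSubsquare LS T → ⟦ I ⟧ ⊑ Intersects LS T → _⊆_ LS (cells I) T
  cells-⊆ (filled , _) I⊑T (r , c) (r∈ , c∈) = filled r c (row-of (I⊑T (row r) r∈)) (col-of (I⊑T (col c) c∈))

  cells-subsquare : ∀ {I} → Closed ⟦ I ⟧ → IsSubsquare LS (cells I)
  cells-subsquare {I} closed =
      (λ { r c (_ , r∈ , _) (_ , _ , c∈) → r∈ , c∈ })
    , (λ { r s (_ , r∈ , _) ((r′ , c′) , (r′∈ , c′∈) , refl) →
           let c , Lrc≡s = occurs-in-row r s
               s∈ = subst (λ x → sym x ∈ₗ I) (≡.sym Lrc≡s) (ClosedAt.sym∈ (closed r′ c′) r′∈ c′∈)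
           in c , (r∈ , ClosedAt.col∈ (closed r c) r∈ s∈) , Lrc≡s })
    , (λ { c s (_ , _ , c∈) ((r′ , c′) , (r′∈ , c′∈) , refl) →
           let r , Lrc≡s = occurs-in-col c s
               s∈ = subst (λ x → sym x ∈ₗ I) (≡.sym Lrc≡s) (ClosedAt.sym∈ (closed r′ c′) r′∈ c′∈)
           in r , (ClosedAt.row∈ (closed r c) c∈ s∈ , c∈) , Lrc≡s })

  Intersects-cells⁻ : ∀ {I} → Closed ⟦ I ⟧ → Intersects LS (cells I) ⊑ ⟦ I ⟧
  Intersects-cells⁻ _ (row _) (_ , (r∈ , _) , refl) = r∈
  Intersects-cells⁻ _ (col _) (_ , (_ , c∈) , refl) = c∈
  Intersects-cells⁻ closed (sym _) ((r , c) , (r∈ , c∈) , refl) = ClosedAt.sym∈ (closed r c) r∈ c∈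

  Intersects-cells⁺ : ∀ {I r₀ c₀} → Closed ⟦ I ⟧ → row r₀ ∈ₗ I → col c₀ ∈ₗ I → ⟦ I ⟧ ⊑ Intersects LS (cells I)
  Intersects-cells⁺ {c₀ = c₀} _ _ c₀∈ (row r) r∈ = (r , c₀) , (r∈ , c₀∈) , refl
  Intersects-cells⁺ {r₀ = r₀} _ r₀∈ _ (col c) c∈ = (r₀ , c) , (r₀∈ , c∈) , refl
  Intersects-cells⁺ {I} {r₀} closed r₀∈ _ (sym s) s∈ =
    let c , L≡s = occurs-in-row r₀ s
    in (r₀ , c) , (r₀∈ , ClosedAt.col∈ (closed r₀ c) r₀∈ (subst (λ x → sym x ∈ₗ I) (≡.sym L≡s) s∈)) , L≡s

  entry-on : ∀ {T r₀ c₀} → IsSubsquare LS T → T (r₀ , c₀) → ∀ ℓ → Intersects LS T ℓ →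
             ∃ λ e → T e × through e ℓ × (proj₁ e ≡ r₀ ⊎ proj₂ e ≡ c₀)
  entry-on {r₀ = r₀} {c₀} (filled , _) e₀∈ (row r) meets =
    (r , c₀) , filled r c₀ (row-of meets) (r₀ , e₀∈) , refl , inj₂ refl
  entry-on {r₀ = r₀} {c₀} (filled , _) e₀∈ (col c) meets =
    (r₀ , c) , filled r₀ c (c₀ , e₀∈) (col-of meets) , refl , inj₁ refl
  entry-on {r₀ = r₀} {c₀} (_ , row-syms , _) e₀∈ (sym s) meets =
    let c , e∈ , L≡s = row-syms r₀ s (c₀ , e₀∈) meets in (r₀ , c) , e∈ , L≡s , inj₁ refl

  data Incomplete (I : LineSet) : Cell LS → Set where
    sym∉ : ∀ {r c} → row r ∈ₗ I → col c ∈ₗ I → sym (L r c) ∉ₗ I → Incomplete I (r , c)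
    col∉ : ∀ {r c} → row r ∈ₗ I → sym (L r c) ∈ₗ I → col c ∉ₗ I → Incomplete I (r , c)
    row∉ : ∀ {r c} → col c ∈ₗ I → sym (L r c) ∈ₗ I → row r ∉ₗ I → Incomplete I (r , c)

  closedAt-or-incomplete : ∀ I r c → ClosedAt ⟦ I ⟧ r c ⊎ Incomplete I (r , c)
  closedAt-or-incomplete I r c
    with implies-or-refuted (row r ∈ₗ? I) (col c ∈ₗ? I) (sym (L r c) ∈ₗ? I)
       | implies-or-refuted (row r ∈ₗ? I) (sym (L r c) ∈ₗ? I) (col c ∈ₗ? I)
       | implies-or-refuted (col c ∈ₗ? I) (sym (L r c) ∈ₗ? I) (row r ∈ₗ? I)
  ... | inj₂ (r∈ , c∈ , s∉) | _ | _ = inj₂ (sym∉ r∈ c∈ s∉)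
  ... | inj₁ _ | inj₂ (r∈ , s∈ , c∉) | _ = inj₂ (col∉ r∈ s∈ c∉)
  ... | inj₁ _ | inj₁ _ | inj₂ (c∈ , s∈ , r∉) = inj₂ (row∉ c∈ s∈ r∉)
  ... | inj₁ s∈ | inj₁ c∈ | inj₁ r∈ = inj₁ record { sym∈ = s∈ ; col∈ = c∈ ; row∈ = r∈ }

  closed-or-incomplete : ∀ I → ∃ (Incomplete I) ⊎ Closed ⟦ I ⟧
  closed-or-incomplete I with all-or-any (λ r → all-or-any (closedAt-or-incomplete I r))
  ... | inj₁ closed = inj₂ closed
  ... | inj₂ (r , c , incomplete) = inj₁ ((r , c) , incomplete)

  incomplete⇒fresh : ∀ {I e} → Incomplete I e → Fresh I e
  incomplete⇒fresh (sym∉ _ _ s∉) = inj₂ (inj₂ s∉)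
  incomplete⇒fresh (col∉ _ _ c∉) = inj₂ (inj₁ c∉)
  incomplete⇒fresh (row∉ _ _ r∉) = inj₁ r∉

  incomplete⇒gain≤1 : ∀ {I e} → Incomplete I e → gain I e ≤ 1
  incomplete⇒gain≤1 {I} {r , c} (sym∉ r∈ c∈ _) = gain-≤ I r c (missing≤0 r∈) (missing≤0 c∈) (missing≤1 _ _)
  incomplete⇒gain≤1 {I} {r , c} (col∉ r∈ s∈ _) = gain-≤ I r c (missing≤0 r∈) (missing≤1 _ _) (missing≤0 s∈)
  incomplete⇒gain≤1 {I} {r , c} (row∉ c∈ s∈ _) = gain-≤ I r c (missing≤1 _ _) (missing≤0 c∈) (missing≤0 s∈)

  incomplete-⊑ : ∀ {I P e} → Closed P → ⟦ I ⟧ ⊑ P → Incomplete I e → through e ⊑ P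
  incomplete-⊑ {e = r , c} closed I⊑P (sym∉ r∈ c∈ _) =
    through-⊑ (I⊑P _ r∈) (I⊑P _ c∈) (ClosedAt.sym∈ (closed r c) (I⊑P _ r∈) (I⊑P _ c∈))
  incomplete-⊑ {e = r , c} closed I⊑P (col∉ r∈ s∈ _) =
    through-⊑ (I⊑P _ r∈) (ClosedAt.col∈ (closed r c) (I⊑P _ r∈) (I⊑P _ s∈)) (I⊑P _ s∈)
  incomplete-⊑ {e = r , c} closed I⊑P (row∉ c∈ s∈ _) =
    through-⊑ (ClosedAt.row∈ (closed r c) (I⊑P _ c∈) (I⊑P _ s∈)) (I⊑P _ c∈) (I⊑P _ s∈)

  fresh⇒size< : ∀ {I} e → Fresh I e → size I < size (I ⊕ e)
  fresh⇒size< {I} e fresh = begin-strict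
    size I              <⟨ m<m+n (size I) (fresh⇒1≤gain I e fresh) ⟩
    size I + gain I e   ≡⟨ ≡.sym (size-⊕ I e) ⟩
    size (I ⊕ e)        ∎
    where open ≤-Reasoning

  -- The fuel 3n + 1 suffices: each added entry is fresh, so the size grows, and sizes are at most 3n.
  saturate : ∀ (P : LineSet → Cell LS → Set) (Q : LineSet → Set) →
             (∀ I → ∃ (P I) ⊎ Q I) → (∀ {I e} → P I e → Fresh I e) →
             ∀ I → ∃ λ xs → Successively P I xs × Q (foldl _⊕_ I xs)
  saturate P Q P-or-Q P⇒fresh I₀ = go (suc (3 * n)) I₀ (m≤n+m _ (size I₀))
    where
    shift : ∀ {a b} k → a < b → a + suc k ≤ b + k
    shift {a} k a<b = ≤-trans (≤-reflexive (+-suc a k)) (+-monoˡ-≤ k a<b)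
    go : ∀ k I → 3 * n < size I + k → ∃ λ xs → Successively P I xs × Q (foldl _⊕_ I xs)
    go zero I overflow = ⊥-elim (≤⇒≯ (size≤3n I) (subst (3 * n <_) (+-identityʳ _) overflow))
    go (suc k) I overflow with P-or-Q I
    ... | inj₂ q = [] , tt , q
    ... | inj₁ (e , p) with go k (I ⊕ e) (<-≤-trans overflow (shift k (fresh⇒size< e (P⇒fresh p))))
    ...   | xs , ps , q = e ∷ xs , (p , ps) , q

  completing : ∀ I → ∃ λ xs → Successively Incomplete I xs × Closed ⟦ foldl _⊕_ I xs ⟧
  completing = saturate Incomplete (Closed ∘ ⟦_⟧) closed-or-incomplete incomplete⇒fresh

  completion : LineSet → List (Cell LS)
  completion I = proj₁ (completing I)

  closure : LineSet → LineSet
  closure I = foldl _⊕_ I (completion I)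

  closure-closed : ∀ I → Closed ⟦ closure I ⟧
  closure-closed I = proj₂ (proj₂ (completing I))

  ⊑-closure : ∀ I → ⟦ I ⟧ ⊑ ⟦ closure I ⟧
  ⊑-closure I = ∈-foldl⁺ˡ (completion I)

  closure-least : ∀ {I P} → Closed P → ⟦ I ⟧ ⊑ P → ⟦ closure I ⟧ ⊑ P
  closure-least {I} {P} closed = completed-⊑ (completion I) (proj₁ (proj₂ (completing I)))
    where
    completed-⊑ : ∀ {J} xs → Successively Incomplete J xs → ⟦ J ⟧ ⊑ P → ⟦ foldl _⊕_ J xs ⟧ ⊑ P
    completed-⊑ [] _ J⊑P = J⊑P
    completed-⊑ (x ∷ xs) (inc , incs) J⊑P = completed-⊑ xs incs (⊕-⊑ x J⊑P (incomplete-⊑ closed J⊑P inc))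

  size-closure : ∀ I → size (closure I) ≤ size I + length (completion I)
  size-closure I = size-completed (completion I) (proj₁ (proj₂ (completing I)))
    where
    size-completed : ∀ {J} xs → Successively Incomplete J xs → size (foldl _⊕_ J xs) ≤ size J + length xs
    size-completed {J} [] _ = ≤-reflexive (≡.sym (+-identityʳ (size J)))
    size-completed {J} (x ∷ xs) (inc , incs) = begin
      size (foldl _⊕_ (J ⊕ x) xs)        ≤⟨ size-completed xs incs ⟩
      size (J ⊕ x) + length xs           ≡⟨ cong (_+ length xs) (size-⊕ J x) ⟩
      size J + gain J x + length xs      ≤⟨ +-monoˡ-≤ (length xs)
                                              (+-monoʳ-≤ (size J) (incomplete⇒gain≤1 inc)) ⟩
      size J + 1 + length xs             ≡⟨ +-assoc (size J) 1 (length xs) ⟩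
      size J + suc (length xs)           ∎
      where open ≤-Reasoning

  insert : Line LS → LineSet → LineSet
  insert (row r) I = record I { rows = rows I ∪ ⁅ r ⁆ }
  insert (col c) I = record I { cols = cols I ∪ ⁅ c ⁆ }
  insert (sym s) I = record I { syms = syms I ∪ ⁅ s ⁆ }

  ∈-insert : ∀ ℓ I → ℓ ∈ₗ insert ℓ I
  ∈-insert (row r) I = q⊆p∪q (rows I) _ (x∈⁅x⁆ r)
  ∈-insert (col c) I = q⊆p∪q (cols I) _ (x∈⁅x⁆ c)
  ∈-insert (sym s) I = q⊆p∪q (syms I) _ (x∈⁅x⁆ s)

  ⊑-insert : ∀ ℓ I → ⟦ I ⟧ ⊑ ⟦ insert ℓ I ⟧
  ⊑-insert (row _) _ (row _) = p⊆p∪q _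
  ⊑-insert (row _) _ (col _) = id
  ⊑-insert (row _) _ (sym _) = id
  ⊑-insert (col _) _ (row _) = id
  ⊑-insert (col _) _ (col _) = p⊆p∪q _
  ⊑-insert (col _) _ (sym _) = id
  ⊑-insert (sym _) _ (row _) = id
  ⊑-insert (sym _) _ (col _) = id
  ⊑-insert (sym _) _ (sym _) = p⊆p∪q _

  ∈-insert⁻ : ∀ ℓ I ℓ′ → ℓ′ ∈ₗ insert ℓ I → ℓ′ ∈ₗ I ⊎ ℓ′ ≡ ℓ
  ∈-insert⁻ (row r) I (row x) x∈ = Sum.map₂ (cong row ∘ x∈⁅y⁆⇒x≡y r) (x∈p∪q⁻ (rows I) _ x∈)
  ∈-insert⁻ (row _) _ (col _) = inj₁
  ∈-insert⁻ (row _) _ (sym _) = inj₁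
  ∈-insert⁻ (col _) _ (row _) = inj₁
  ∈-insert⁻ (col c) I (col x) x∈ = Sum.map₂ (cong col ∘ x∈⁅y⁆⇒x≡y c) (x∈p∪q⁻ (cols I) _ x∈)
  ∈-insert⁻ (col _) _ (sym _) = inj₁
  ∈-insert⁻ (sym _) _ (row _) = inj₁
  ∈-insert⁻ (sym _) _ (col _) = inj₁
  ∈-insert⁻ (sym s) I (sym x) x∈ = Sum.map₂ (cong sym ∘ x∈⁅y⁆⇒x≡y s) (x∈p∪q⁻ (syms I) _ x∈)

  adjoin : Line LS → LineSet → LineSet
  adjoin ℓ I = closure (insert ℓ I)

  ⊑-adjoin : ∀ ℓ I → ⟦ I ⟧ ⊑ ⟦ adjoin ℓ I ⟧
  ⊑-adjoin ℓ I ℓ′ = ⊑-closure (insert ℓ I) ℓ′ ∘ ⊑-insert ℓ I ℓ′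

  ∈-adjoin : ∀ ℓ I → ℓ ∈ₗ adjoin ℓ I
  ∈-adjoin ℓ I = ⊑-closure (insert ℓ I) ℓ (∈-insert ℓ I)

  adjoin-least : ∀ {ℓ I P} → Closed P → ⟦ I ⟧ ⊑ P → P ℓ → ⟦ adjoin ℓ I ⟧ ⊑ P
  adjoin-least {ℓ} {I} {P} closed I⊑P Pℓ = closure-least closed λ ℓ′ ℓ′∈ →
    [ I⊑P ℓ′ , (λ { refl → Pℓ }) ] (∈-insert⁻ ℓ I ℓ′ ℓ′∈)

  -- The lines of the successive members of a connected chain, started at a single entry.
  data Growth : ℕ → LineSet → Set where
    start : ∀ e → Growth 1 (∅ ⊕ e)
    grow  : ∀ {α I} → Growth α I → ∀ ℓ → ℓ ∉ₗ I → Growth (suc α) (adjoin ℓ I)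

  origin : ∀ {α I} → Growth α I → Cell LS
  origin (start e) = e
  origin (grow g _ _) = origin g

  growth-length : ∀ {α I} → Growth α I → 1 ≤ α
  growth-length (start _) = s≤s z≤n
  growth-length (grow _ _ _) = s≤s z≤n

  growth-closed : ∀ {α I} → Growth α I → Closed ⟦ I ⟧
  growth-closed (start e) = ∅⊕-closed e
  growth-closed (grow {I = I} _ ℓ _) = closure-closed (insert ℓ I)

  -- stage g i is the i-th member for 1 ≤ i ≤ α, the first one for i = 0, and the last one for i > α.
  stage : ∀ {α I} → Growth α I → ℕ → LineSet
  stage (start e) _ = ∅ ⊕ e
  stage (grow {α} {I} g ℓ _) i with i ≤? α
  ... | yes _ = stage g i
  ... | no _ = adjoin ℓ I

  stage-closed : ∀ {α I} (g : Growth α I) i → Closed ⟦ stage g i ⟧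
  stage-closed (start e) _ = ∅⊕-closed e
  stage-closed (grow {α} g ℓ _) i with i ≤? α
  ... | yes _ = stage-closed g i
  ... | no _ = closure-closed _

  stage-last : ∀ {α I} (g : Growth α I) → stage g α ≡ I
  stage-last (start _) = refl
  stage-last (grow {α} g ℓ _) with suc α ≤? α
  ... | yes α<α = ⊥-elim (<-irrefl refl α<α)
  ... | no _ = refl

  stage-⊑ : ∀ {α I} (g : Growth α I) i → ⟦ stage g i ⟧ ⊑ ⟦ I ⟧
  stage-⊑ (start _) _ _ = id
  stage-⊑ (grow {α} {I} g ℓ _) i with i ≤? α
  ... | yes _ = λ ℓ′ → ⊑-adjoin ℓ I ℓ′ ∘ stage-⊑ g i ℓ′
  ... | no _ = λ _ → id

  stage-mono : ∀ {α I} (g : Growth α I) i → ⟦ stage g i ⟧ ⊑ ⟦ stage g (suc i) ⟧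
  stage-mono (start _) _ _ = id
  stage-mono (grow {α} {I} g ℓ _) i with i ≤? α | suc i ≤? α
  ... | yes _ | yes _ = stage-mono g i
  ... | yes _ | no _ = λ ℓ′ → ⊑-adjoin ℓ I ℓ′ ∘ stage-⊑ g i ℓ′
  ... | no i≰α | yes i<α = ⊥-elim (i≰α (≤-trans (n≤1+n i) i<α))
  ... | no _ | no _ = λ _ → id

  origin-⊑-stage : ∀ {α I} (g : Growth α I) i → through (origin g) ⊑ ⟦ stage g i ⟧
  origin-⊑-stage (start e) _ = ∈-⊕⁺ʳ e
  origin-⊑-stage (grow {α} {I} g ℓ _) i with i ≤? α
  ... | yes _ = origin-⊑-stage g i
  ... | no _ = λ ℓ′ → ⊑-adjoin ℓ I ℓ′ ∘ stage-⊑ g α ℓ′ ∘ origin-⊑-stage g α ℓ′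

  stage-one-⊑ : ∀ {α I} (g : Growth α I) → ⟦ stage g 1 ⟧ ⊑ through (origin g)
  stage-one-⊑ (start e) = ∅⊕-⊑ e
  stage-one-⊑ (grow {α} g ℓ _) with 1 ≤? α
  ... | yes _ = stage-one-⊑ g
  ... | no 1≰α = ⊥-elim (1≰α (growth-length g))

  record Adjoining (I J : LineSet) : Set₁ where
    field
      line  : Line LS
      line∉ : line ∉ₗ I
      line∈ : line ∈ₗ J
      least : ∀ {P} → Closed P → ⟦ I ⟧ ⊑ P → P line → ⟦ J ⟧ ⊑ P

  adjoining : ∀ ℓ I → ℓ ∉ₗ I → Adjoining I (adjoin ℓ I)
  adjoining ℓ I ℓ∉ = record { line = ℓ ; line∉ = ℓ∉ ; line∈ = ∈-adjoin ℓ I ; least = adjoin-least }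

  stage-step : ∀ {α I} (g : Growth α I) i → 1 ≤ i → suc i ≤ α → Adjoining (stage g i) (stage g (suc i))
  stage-step (start _) (suc _) _ (s≤s ())
  stage-step (grow {α} {I} g ℓ ℓ∉) i 1≤i (s≤s i≤α) with i ≤? α | suc i ≤? α
  ... | yes _ | yes i<α = stage-step g i 1≤i i<α
  ... | yes _ | no i≮α = subst (λ J → Adjoining J (adjoin ℓ I)) stage-i≡I (adjoining ℓ I ℓ∉)
    where
    stage-i≡I : I ≡ stage g i
    stage-i≡I = ≡.trans (≡.sym (stage-last g)) (cong (stage g) (≡.sym (≤-antisym i≤α (≮⇒≥ i≮α))))
  ... | no i≰α | _ = ⊥-elim (i≰α i≤α)

  chain : ∀ {α I} → Growth α I → ℕ → Entries LS
  chain g zero _ = ⊥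
  chain g (suc i) = cells (stage g (suc i))

  empty-subsquare : IsSubsquare LS (λ _ → ⊥)
  empty-subsquare = (λ { _ _ (_ , ()) _ }) , (λ { _ _ (_ , ()) _ }) , (λ { _ _ (_ , ()) _ })

  origin∈stage : ∀ {α I} (g : Growth α I) i → cells (stage g i) (origin g)
  origin∈stage g i = origin-⊑-stage g i (row _) refl , origin-⊑-stage g i (col _) refl

  stage⊑Intersects : ∀ {α I} (g : Growth α I) i → ⟦ stage g i ⟧ ⊑ Intersects LS (cells (stage g i))
  stage⊑Intersects g i = Intersects-cells⁺ (stage-closed g i) (origin-⊑-stage g i (row _) refl)
                                           (origin-⊑-stage g i (col _) refl)

  chain-last : ∀ {α I} (g : Growth α I) → Full I → ∀ e → chain g α e
  chain-last {zero} g _ _ with growth-length g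
  ... | ()
  chain-last {suc α} g full (r , c) =
    subst (λ J → cells J (r , c)) (≡.sym (stage-last g)) (full (row r) , full (col c))

  chain-connected : ∀ {α I} (g : Growth α I) → IsConnected LS α (chain g)
  chain-connected g zero _ =
    row (proj₁ (origin g)) , (origin g , origin∈stage g 1 , refl) , (λ { (_ , () , _) }) , λ ()
  chain-connected g (suc i) i<α = line , meets , misses , λ _ → smallest
    where
    open Adjoining (stage-step g (suc i) (s≤s z≤n) i<α)
    meets : Intersects LS (chain g (suc (suc i))) line
    meets = stage⊑Intersects g (suc (suc i)) line line∈
    misses : ¬ Intersects LS (chain g (suc i)) line
    misses = line∉ ∘ Intersects-cells⁻ (stage-closed g (suc i)) line
    smallest : IsSmallest LS (chain g (suc i)) line (chain g (suc (suc i)))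
    smallest = cells-subsquare (stage-closed g (suc (suc i))) , meets , cells-mono (stage-mono g (suc i))
             , λ T T-subsquare T-meets S⊆T → cells-⊆ T-subsquare
                 (least (subsquare⇒closed T-subsquare)
                        (λ ℓ → Intersects-mono S⊆T ℓ ∘ stage⊑Intersects g (suc i) ℓ) T-meets)

  growth⇒chain : ∀ {α I} (g : Growth α I) → Full I → IsChain LS α (chain g) × IsConnected LS α (chain g)
  growth⇒chain {α} g full =
      ( growth-length g , subsquare , nested , (λ _ ()) , (origin g , origin∈stage g 1 , single)
      , chain-last g full )
    , chain-connected g
    where
    subsquare : ∀ i → i ≤ α → IsSubsquare LS (chain g i)
    subsquare zero _ = empty-subsquare
    subsquare (suc i) _ = cells-subsquare (stage-closed g (suc i))
    nested : ∀ i → suc i ≤ α → _⊆_ LS (chain g i) (chain g (suc i))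
    nested zero _ _ ()
    nested (suc i) _ = cells-mono (stage-mono g (suc i))
    single : ∀ e → cells (stage g 1) e → e ≡ origin g
    single (r , c) (r∈ , c∈) = cong₂ _,_ (≡.sym (stage-one-⊑ g (row r) r∈)) (≡.sym (stage-one-⊑ g (col c) c∈))

  Absorption : ℕ → LineSet → LineSet → Cell LS → Set
  Absorption α Y I e = ∃₂ λ α′ Y′ → Growth α′ Y′ × ⟦ Y ⟧ ⊑ ⟦ Y′ ⟧ × through e ⊑ ⟦ Y′ ⟧ × suc α′ ≤ gain I e + α

  absorb-new-row-col : ∀ {α Y I r c} → Growth α Y → ⟦ I ⟧ ⊑ ⟦ Y ⟧ → row r ∉ₗ Y → col c ∉ₗ Y →
                       Absorption α Y I (r , c)
  absorb-new-row-col {α} {Y} {I} {r} {c} g I⊑Y r∉ c∉ with col c ∈ₗ? adjoin (row r) Y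
  ... | yes c∈₁ =
    suc α , Y₁ , grow g (row r) r∉ , ⊑-adjoin (row r) Y , cell-⊑ (closure-closed _) r∈₁ c∈₁ ,
    +-monoˡ-≤ α (gain-≥ I r c (1≤missing (r∉ ∘ I⊑Y (row r))) (1≤missing (c∉ ∘ I⊑Y (col c))) z≤n)
    where
    Y₁ = adjoin (row r) Y
    r∈₁ : row r ∈ₗ Y₁
    r∈₁ = ∈-adjoin (row r) Y
  ... | no c∉₁ =
    suc (suc α) , Y₂ , grow (grow g (row r) r∉) (col c) c∉₁ ,
    (λ ℓ → ⊑-adjoin (col c) Y₁ ℓ ∘ ⊑-adjoin (row r) Y ℓ) ,
    cell-⊑ (closure-closed _) (⊑-adjoin (col c) Y₁ (row r) r∈₁) (∈-adjoin (col c) Y₁) ,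
    +-monoˡ-≤ α (gain-≥ I r c (1≤missing (r∉ ∘ I⊑Y (row r))) (1≤missing (c∉ ∘ I⊑Y (col c))) (1≤missing s∉))
    where
    Y₁ = adjoin (row r) Y
    Y₂ = adjoin (col c) Y₁
    r∈₁ : row r ∈ₗ Y₁
    r∈₁ = ∈-adjoin (row r) Y
    s∉ : sym (L r c) ∉ₗ I
    s∉ s∈ = c∉₁ (ClosedAt.col∈ (closure-closed _ r c) r∈₁
                  (⊑-adjoin (row r) Y (sym (L r c)) (I⊑Y (sym (L r c)) s∈)))

  absorb : ∀ {α Y I} → Growth α Y → ⟦ I ⟧ ⊑ ⟦ Y ⟧ → ∀ e → Fresh I e → Absorption α Y I e
  absorb {α} {Y} {I} g I⊑Y (r , c) fresh with row r ∈ₗ? Y | col c ∈ₗ? Y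
  ... | yes r∈ | yes c∈ =
    α , Y , g , (λ _ → id) , cell-⊑ (growth-closed g) r∈ c∈ , +-monoˡ-≤ α (fresh⇒1≤gain I (r , c) fresh)
  ... | yes r∈ | no c∉ =
    suc α , adjoin (col c) Y , grow g (col c) c∉ , ⊑-adjoin (col c) Y ,
    cell-⊑ (closure-closed _) (⊑-adjoin (col c) Y (row r) r∈) (∈-adjoin (col c) Y) ,
    +-monoˡ-≤ α (gain-≥ I r c z≤n (1≤missing (c∉ ∘ I⊑Y (col c)))
                  (1≤missing (c∉ ∘ ClosedAt.col∈ (growth-closed g r c) r∈ ∘ I⊑Y (sym (L r c)))))
  ... | no r∉ | yes c∈ =
    suc α , adjoin (row r) Y , grow g (row r) r∉ , ⊑-adjoin (row r) Y ,
    cell-⊑ (closure-closed _) (∈-adjoin (row r) Y) (⊑-adjoin (row r) Y (col c) c∈) ,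
    +-monoˡ-≤ α (gain-≥ I r c (1≤missing (r∉ ∘ I⊑Y (row r))) z≤n
                  (1≤missing (r∉ ∘ ClosedAt.row∈ (growth-closed g r c) c∈ ∘ I⊑Y (sym (L r c)))))
  ... | no r∉ | no c∉ = absorb-new-row-col g I⊑Y r∉ c∉

  record Tracker (I : LineSet) (m : ℕ) : Set where
    constructor tracker
    field
      α : ℕ
      top : LineSet
      growth : Growth α top
      I⊑top : ⟦ I ⟧ ⊑ ⟦ top ⟧
      bound : suc (α + m) ≤ size I

  start-tracker : ∀ e → Tracker (∅ ⊕ e) 1
  start-tracker e = tracker 1 (∅ ⊕ e) (start e) (λ _ → id) (≤-reflexive (≡.sym (size-∅⊕ e)))

  track-step : ∀ {I m} → Tracker I m → ∀ e → Fresh I e → Tracker (I ⊕ e) (suc m)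
  track-step {I} {m} (tracker α Y g I⊑Y bound) e fresh with absorb g I⊑Y e fresh
  ... | α′ , Y′ , g′ , Y⊑Y′ , e⊑Y′ , cost =
    tracker α′ Y′ g′ (⊕-⊑ e (λ ℓ → Y⊑Y′ ℓ ∘ I⊑Y ℓ) e⊑Y′) (begin
      suc α′ + suc m            ≤⟨ +-monoˡ-≤ (suc m) cost ⟩
      gain I e + α + suc m      ≡⟨ regroup (gain I e) α m ⟩
      suc (α + m) + gain I e    ≤⟨ +-monoˡ-≤ (gain I e) bound ⟩
      size I + gain I e         ≡⟨ ≡.sym (size-⊕ I e) ⟩
      size (I ⊕ e)              ∎)
    where
    open ≤-Reasoning
    regroup : ∀ g a m → g + a + suc m ≡ suc (a + m) + g
    regroup = solve-∀

  track : ∀ {I m} → Tracker I m → ∀ es → Successively Fresh I es → Tracker (foldl _⊕_ I es) (m + length es)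
  track {I} {m} t [] _ = subst (Tracker I) (≡.sym (+-identityʳ m)) t
  track {I} {m} t (e ∷ es) (fresh , freshes) =
    subst (Tracker _) (≡.sym (+-suc m (length es))) (track (track-step t e fresh) es freshes)

  coverSeq⇒chain : Fin n → ∀ es → IsCoverSeq LS es →
                   ∃₂ λ α S → IsChain LS α S × IsConnected LS α S × suc (α + length es) ≤ 3 * n
  coverSeq⇒chain z [] ((rows-covered , _) , _) with rows-covered z
  ... | ()
  coverSeq⇒chain _ (e ∷ es) isCoverSeq with coverSeq⇒full×fresh (e ∷ es) isCoverSeq
  ... | full , (_ , fresh) with track (start-tracker e) es fresh
  ... | tracker α Y g I⊑Y bound =
    let isChain , connected = growth⇒chain g (λ ℓ → I⊑Y ℓ (full ℓ))
    in α , chain g , isChain , connected , ≤-trans bound (size≤3n (covered (e ∷ es)))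

  module FromChain {α : ℕ} {S : ℕ → Entries LS}
    (subsquare : ∀ i → i ≤ α → IsSubsquare LS (S i))
    (nested : ∀ i → suc i ≤ α → _⊆_ LS (S i) (S (suc i)))
    (e₀ : Cell LS) (e₀∈ : S 1 e₀) (unique : ∀ e → S 1 e → e ≡ e₀)
    (connected : IsConnected LS α S) where

    e₀∈S : ∀ i → suc i ≤ α → S (suc i) e₀
    e₀∈S zero _ = e₀∈
    e₀∈S (suc i) i<α = nested (suc i) i<α e₀ (e₀∈S i (≤-trans (n≤1+n _) i<α))

    record Covering (i : ℕ) : Set where
      field
        pre : List (Cell LS)
        fresh : Successively Fresh ∅ pre
        ⊑S : ⟦ covered pre ⟧ ⊑ Intersects LS (S i)
        S⊑ : Intersects LS (S i) ⊑ ⟦ covered pre ⟧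
        bound : size (covered pre) ≤ suc (i + length pre)

    initial : Covering 1
    initial = record
      { pre = e₀ ∷ []
      ; fresh = fresh-on (row (proj₁ e₀)) refl (∉∅ (row (proj₁ e₀))) , tt
      ; ⊑S = λ ℓ ℓ∈ → e₀ , e₀∈ , ∅⊕-⊑ e₀ ℓ ℓ∈
      ; S⊑ = λ { ℓ (e , e∈ , on) → ∈-⊕⁺ʳ e₀ ℓ (subst (λ x → through x ℓ) (unique e e∈) on) }
      ; bound = ≤-reflexive (size-∅⊕ e₀)
      }

    extend : ∀ i → suc (suc i) ≤ α → Covering (suc i) → Covering (suc (suc i))
    extend i i<α cov with connected (suc i) i<α
    ... | ℓ , meets , misses , smallest with entry-on (subsquare (suc (suc i)) i<α) (e₀∈S (suc i) i<α) ℓ meets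
    ... | (r , c) , e∈ , on , shares-row-or-col = record
      { pre = pre ++ (r , c) ∷ xs
      ; fresh = Successively-++ pre fresh
                  ( fresh-on ℓ on (misses ∘ ⊑S ℓ)
                  , Successively-map incomplete⇒fresh xs (proj₁ (proj₂ (completing J))) )
      ; ⊑S = subst (λ X → ⟦ X ⟧ ⊑ _) (≡.sym covered≡)
               (closure-least (subsquare⇒closed (subsquare (suc (suc i)) i<α))
                 (⊕-⊑ (r , c) (λ ℓ′ → Intersects-mono (nested (suc i) i<α) ℓ′ ∘ ⊑S ℓ′)
                              (λ ℓ′ on′ → (r , c) , e∈ , on′)))
      ; S⊑ = subst (λ X → _ ⊑ ⟦ X ⟧) (≡.sym covered≡)
               (λ ℓ′ → Intersects-cells⁻ (closure-closed J) ℓ′ ∘ Intersects-mono S⊆ ℓ′)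
      ; bound = subst₂ (λ X k → size X ≤ suc (suc (suc i) + k)) (≡.sym covered≡) (≡.sym (length-++ pre))
                  bound′
      }
      where
      open Covering cov
      J = covered pre ⊕ (r , c)
      xs = completion J
      covered≡ : covered (pre ++ (r , c) ∷ xs) ≡ closure J
      covered≡ = foldl-++ _⊕_ ∅ pre ((r , c) ∷ xs)
      e∈closure : cells (closure J) (r , c)
      e∈closure = ⊑-closure J (row r) (∈-⊕⁺ʳ {covered pre} (r , c) (row r) refl)
                , ⊑-closure J (col c) (∈-⊕⁺ʳ {covered pre} (r , c) (col c) refl)
      S⊆ : _⊆_ LS (S (suc (suc i))) (cells (closure J))
      S⊆ = proj₂ (proj₂ (proj₂ (smallest (s≤s z≤n)))) (cells (closure J)) (cells-subsquare (closure-closed J))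
             ((r , c) , e∈closure , on) (⊆-cells (λ ℓ′ → ⊑-closure J ℓ′ ∘ ∈-⊕⁺ˡ (r , c) ℓ′ ∘ S⊑ ℓ′))
      e₀-lines : through e₀ ⊑ ⟦ covered pre ⟧
      e₀-lines ℓ′ on′ = S⊑ ℓ′ (e₀ , e₀∈S i (≤-trans (n≤1+n _) i<α) , on′)
      gain≤2 : gain (covered pre) (r , c) ≤ 2
      gain≤2 = [ (λ r≡r₀ → gain-≤ (covered pre) r c (missing≤0 (e₀-lines (row r) (≡.sym r≡r₀)))
                                   (missing≤1 _ _) (missing≤1 _ _))
               , (λ c≡c₀ → gain-≤ (covered pre) r c (missing≤1 _ _)
                                   (missing≤0 (e₀-lines (col c) (≡.sym c≡c₀))) (missing≤1 _ _))
               ] shares-row-or-col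
      bound′ : size (closure J) ≤ suc (suc (suc i) + (length pre + suc (length xs)))
      bound′ = begin
        size (closure J)                                      ≤⟨ size-closure J ⟩
        size J + length xs                                    ≡⟨ cong (_+ length xs) (size-⊕ (covered pre) (r , c)) ⟩
        size (covered pre) + gain (covered pre) (r , c)
          + length xs                                         ≤⟨ +-monoˡ-≤ (length xs) (+-mono-≤ bound gain≤2) ⟩
        suc (suc i + length pre) + 2 + length xs              ≡⟨ regroup i (length pre) (length xs) ⟩
        suc (suc (suc i) + (length pre + suc (length xs)))    ∎
        where
        open ≤-Reasoning
        regroup : ∀ i p x → suc (suc i + p) + 2 + x ≡ suc (suc (suc i) + (p + suc x))
        regroup = solve-∀

    reach : ∀ i → suc i ≤ α → Covering (suc i)
    reach zero _ = initial
    reach (suc i) i<α = extend i i<α (reach i (≤-trans (n≤1+n _) i<α))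

    covering⇒coverSeq : ∀ {i} → Covering i → (∀ e → S i e) →
                        ∃ λ es → IsCoverSeq LS es × 3 * n ≤ suc (i + length es)
    covering⇒coverSeq {i} cov all∈ =
      pre , full×fresh⇒coverSeq pre full fresh , ≤-trans (full⇒3n≤size full) bound
      where
      open Covering cov
      full : Full (covered pre)
      full (row r) = S⊑ (row r) ((r , r) , all∈ (r , r) , refl)
      full (col c) = S⊑ (col c) ((c , c) , all∈ (c , c) , refl)
      full (sym s) = let c , L≡s = occurs-in-row (proj₁ e₀) s in S⊑ (sym s) ((proj₁ e₀ , c) , all∈ _ , L≡s)

  chain⇒coverSeq : ∀ {α S} → IsChain LS α S → IsConnected LS α S →
                   ∃ λ es → IsCoverSeq LS es × 3 * n ≤ suc (α + length es)
  chain⇒coverSeq {zero} (() , _) _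
  chain⇒coverSeq {suc α} (_ , subsquare , nested , _ , (e₀ , e₀∈ , unique) , all∈) connected =
    covering⇒coverSeq (reach α ≤-refl) all∈
    where open FromChain subsquare nested e₀ e₀∈ unique connected

  any-cell? : ∀ {P : Cell LS → Set} → (∀ e → Dec (P e)) → Dec (∃ P)
  any-cell? P? = Dec.map′ (λ (r , c , p) → (r , c) , p) (λ ((r , c) , p) → r , c , p)
                          (any? λ r → any? λ c → P? (r , c))

  isCoverSeq? : ∀ es → Dec (IsCoverSeq LS es)
  isCoverSeq? es = (all? (λ r → Any.any? (λ e → proj₁ e ≟ r) es)
                    ×-dec all? (λ c → Any.any? (λ e → proj₂ e ≟ c) es)
                    ×-dec all? (λ s → Any.any? (λ e → L (proj₁ e) (proj₂ e) ≟ s) es))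
                   ×-dec all? (λ i → hasNew? (take (toℕ i) es) (lookup es i))
    where
    hasNew? : ∀ pre e → Dec (HasNew LS pre e)
    hasNew? pre (r , c) = ¬? (Any.any? (λ e → proj₁ e ≟ r) pre)
                          ⊎-dec ¬? (Any.any? (λ e → proj₂ e ≟ c) pre)
                          ⊎-dec ¬? (Any.any? (λ e → L (proj₁ e) (proj₂ e) ≟ L r c) pre)

  fresh-or-full : ∀ I → ∃ (Fresh I) ⊎ Full I
  fresh-or-full I with all-or-any (λ r → toSum (r ∈? rows I)) | all-or-any (λ c → toSum (c ∈? cols I))
                     | all-or-any (λ s → toSum (s ∈? syms I))
  ... | inj₂ (r , r∉) | _ | _ = inj₁ ((r , r) , inj₁ r∉)
  ... | _ | inj₂ (c , c∉) | _ = inj₁ ((c , c) , inj₂ (inj₁ c∉))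
  ... | _ | _ | inj₂ (s , s∉) = let c , L≡s = occurs-in-row s s
                                in inj₁ ((s , c) , inj₂ (inj₂ (subst (_∉ syms I) (≡.sym L≡s) s∉)))
  ... | inj₁ rows∈ | inj₁ cols∈ | inj₁ syms∈ =
    inj₂ λ { (row r) → rows∈ r ; (col c) → cols∈ c ; (sym s) → syms∈ s }

  coverSeq-exists : ∃ (IsCoverSeq LS)
  coverSeq-exists =
    let es , fresh , full = saturate Fresh Full fresh-or-full id ∅
    in  es , full×fresh⇒coverSeq es full fresh

  coverSeq-length≤3n : Fin n → ∀ es → IsCoverSeq LS es → length es ≤ 3 * n
  coverSeq-length≤3n z es isCoverSeq =
    let α , _ , _ , _ , bound = coverSeq⇒chain z es isCoverSeq
    in  ≤-trans (m≤n+m _ α) (≤-trans (n≤1+n _) bound)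

  mcs-exists : Fin n → ∃ (IsMCS LS)
  mcs-exists z =
    let es , isCoverSeq = coverSeq-exists
        m , witness , maximal = greatest (∃-list? any-cell? isCoverSeq?)
                                  (λ { _ (es′ , isCoverSeq′ , refl) → coverSeq-length≤3n z es′ isCoverSeq′ })
                                  (es , isCoverSeq , refl)
    in  m , witness , λ es′ isCoverSeq′ → maximal (length es′) (es′ , isCoverSeq′ , refl)

theorem2p6 : ∀ {n : ℕ} (L : LatinSquare n) → 1 ≤ n →
    Σ ℕ λ m → Σ ℕ λ k → IsMCS L m × IsSCC L k × m + k + 1 ≡ 3 * n
theorem2p6 {suc n} L (s≤s z≤n) = from-mcs (mcs-exists L zero)
  where
  from-mcs : ∃ (IsMCS L) → Σ ℕ λ m → Σ ℕ λ k → IsMCS L m × IsSCC L k × m + k + 1 ≡ 3 * suc n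
  from-mcs (m , isMCS@((es , isCoverSeq , refl) , maximal)) with coverSeq⇒chain L zero es isCoverSeq
  ... | α , S , isChain , connected , upper =
    m , α , isMCS , ((S , isChain , connected) , minimal)
    , ≤-antisym (≤-trans (≤-reflexive (regroup m α)) upper)
                (≤-trans (lower isChain connected) (≤-reflexive (≡.sym (regroup m α))))
    where
    lower : ∀ {α′ S′} → IsChain L α′ S′ → IsConnected L α′ S′ → 3 * suc n ≤ suc (α′ + m)
    lower isChain′ connected′ with chain⇒coverSeq L isChain′ connected′
    ... | es′ , isCoverSeq′ , bound = ≤-trans bound (s≤s (+-monoʳ-≤ _ (maximal es′ isCoverSeq′)))
    minimal : ∀ α′ S′ → IsChain L α′ S′ → IsConnected L α′ S′ → α ≤ α′
    minimal α′ _ isChain′ connected′ = +-cancelʳ-≤ m α α′ (≤-pred (≤-trans upper (lower isChain′ connected′)))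
    regroup : ∀ m α → m + α + 1 ≡ suc (α + m)
    regroup = solve-∀
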